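{- Let $H$ be a $4$-critical graph with no $(7,2)$-colouring, let $v\in V(H)$ with $N(v)=\{x,y,z\}$, and let $G$ be the $C_6$-expansion of $H$ with respect to $v$. Then $G$ is $4$-critical and has no $(7,2)$-colouring.
   Context: A graph is $4$-critical if its chromatic number is $4$ but every proper subgraph is $3$-colourable. A $(7,2)$-colouring is a map $f:V\to\{0,\dots,6\}$ with $2\le|f(u)-f(w)|\le5$ for every edge $uw$. For a vertex $v$ with $N(v)=\{x,y,z\}$, the $C_6$-expansion of $H$ with respect to $v$ is obtained by deleting $v$ and adding four new vertices $x',y',z',w$ with edges $x'y,x'z,x'w,y'x,y'z,y'w,z'x,z'y,z'w$. -}

module Defs where

open import Data.Nat using (ℕ; _≤_; ∣_-_∣)
open import Data.Fin using (Fin; toℕ)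
open import Data.Bool using (Bool; true; false; _∨_)
open import Data.Product using (Σ; _×_; ∃; ∃-syntax)
open import Data.Sum using (_⊎_)
open import Relation.Nullary using (¬_; Dec; yes; no)
open import Relation.Nullary.Decidable using (⌊_⌋)
open import Relation.Binary.PropositionalEquality using (_≡_; _≢_; refl)
open import Function.Bundles using (_↔_)

record Graph : Set₁ where
  field
    V      : Set
    _≟_    : (a b : V) → Dec (a ≡ b)
    adj    : V → V → Bool
    sym    : ∀ a b → adj a b ≡ adj b a
    irrefl : ∀ a → adj a a ≡ false

open Graph public

Edge : (G : Graph) → V G → V G → Set
Edge G a b = adj G a b ≡ true

IsFinite : Graph → Set
IsFinite G = Σ ℕ λ n → Fin n ↔ V G

Colourable : ℕ → Graph → Set
Colourable k G = Σ (V G → Fin k) λ c → ∀ a b → Edge G a b → c a ≢ c b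

record Subgraph (G : Graph) : Set₁ where
  field
    S     : V G → Set
    F     : V G → V G → Set
    F-sym : ∀ a b → F a b → F b a
    F⊆E   : ∀ a b → F a b → Edge G a b × S a × S b

open Subgraph public

IsProper : {G : Graph} → Subgraph G → Set
IsProper {G} H = (∃[ a ] ¬ S H a) ⊎ (∃[ a ] ∃[ b ] (Edge G a b × ¬ F H a b))

SubColourable : ℕ → {G : Graph} → Subgraph G → Set
SubColourable k {G} H =
  Σ ((a : V G) → S H a → Fin k) λ c →
    ∀ a b (f : F H a b) →
      c a (Data.Product.proj₁ (Data.Product.proj₂ (F⊆E H a b f)))
        ≢ c b (Data.Product.proj₂ (Data.Product.proj₂ (F⊆E H a b f)))

ChromaticNumberIs4 : Graph → Set
ChromaticNumberIs4 G = Colourable 4 G × ¬ Colourable 3 G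

FourCritical : Graph → Set₁
FourCritical G =
  ChromaticNumberIs4 G × ((H : Subgraph G) → IsProper H → SubColourable 3 H)

Col72 : Graph → Set
Col72 G = Σ (V G → Fin 7) λ f → ∀ a b → Edge G a b →
  (2 ≤ ∣ toℕ (f a) - toℕ (f b) ∣) × (∣ toℕ (f a) - toℕ (f b) ∣ ≤ 5)

NbhdIs : (G : Graph) → V G → V G → V G → V G → Set
NbhdIs G v x y z =
  x ≢ y × x ≢ z × y ≢ z ×
  Edge G v x × Edge G v y × Edge G v z ×
  (∀ u → Edge G v u → u ≡ x ⊎ u ≡ y ⊎ u ≡ z)

data ExpV (A : Set) (v : A) : Set where
  old : (a : A) → .(a ≢ v) → ExpV A v
  x′ y′ z′ w : ExpV A v

module Expansion (H : Graph) (v x y z : V H) where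
  private
    _≟H_ = _≟_ H
    is : V H → V H → Bool
    is a b = ⌊ a ≟H b ⌋

  EV : Set
  EV = ExpV (V H) v

  eqE : (a b : EV) → Dec (a ≡ b)
  eqE (old a _) (old b _) with a ≟H b
  ... | yes refl = yes refl
  ... | no ne = no λ { refl → ne refl }
  eqE (old _ _) x′ = no λ ()
  eqE (old _ _) y′ = no λ ()
  eqE (old _ _) z′ = no λ ()
  eqE (old _ _) w = no λ ()
  eqE x′ (old _ _) = no λ ()
  eqE x′ x′ = yes refl
  eqE x′ y′ = no λ ()
  eqE x′ z′ = no λ ()
  eqE x′ w = no λ ()
  eqE y′ (old _ _) = no λ ()
  eqE y′ x′ = no λ ()
  eqE y′ y′ = yes refl
  eqE y′ z′ = no λ ()
  eqE y′ w = no λ ()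
  eqE z′ (old _ _) = no λ ()
  eqE z′ x′ = no λ ()
  eqE z′ y′ = no λ ()
  eqE z′ z′ = yes refl
  eqE z′ w = no λ ()
  eqE w (old _ _) = no λ ()
  eqE w x′ = no λ ()
  eqE w y′ = no λ ()
  eqE w z′ = no λ ()
  eqE w w = yes refl

  adjE : EV → EV → Bool
  adjE (old a _) (old b _) = adj H a b
  adjE (old a _) x′ = is a y ∨ is a z
  adjE (old a _) y′ = is a x ∨ is a z
  adjE (old a _) z′ = is a x ∨ is a y
  adjE (old a _) w = false
  adjE x′ (old b _) = is b y ∨ is b z
  adjE y′ (old b _) = is b x ∨ is b z
  adjE z′ (old b _) = is b x ∨ is b y
  adjE w (old b _) = false
  adjE x′ w = true
  adjE y′ w = true
  adjE z′ w = true
  adjE w x′ = true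
  adjE w y′ = true
  adjE w z′ = true
  adjE _ _ = false

  symE : ∀ a b → adjE a b ≡ adjE b a
  symE (old a _) (old b _) = sym H a b
  symE (old a _) x′ = refl
  symE (old a _) y′ = refl
  symE (old a _) z′ = refl
  symE (old a _) w = refl
  symE x′ (old b _) = refl
  symE y′ (old b _) = refl
  symE z′ (old b _) = refl
  symE w (old b _) = refl
  symE x′ x′ = refl
  symE x′ y′ = refl
  symE x′ z′ = refl
  symE x′ w = refl
  symE y′ x′ = refl
  symE y′ y′ = refl
  symE y′ z′ = refl
  symE y′ w = refl
  symE z′ x′ = refl
  symE z′ y′ = refl
  symE z′ z′ = refl
  symE z′ w = refl
  symE w x′ = refl
  symE w y′ = refl
  symE w z′ = refl
  symE w w = refl

  irreflE : ∀ a → adjE a a ≡ false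
  irreflE (old a _) = irrefl H a
  irreflE x′ = refl
  irreflE y′ = refl
  irreflE z′ = refl
  irreflE w = refl

  C6Expansion : Graph
  C6Expansion = record
    { V = EV ; _≟_ = eqE ; adj = adjE ; sym = symE ; irrefl = irreflE }

C6Expansion : (H : Graph) (v x y z : V H) → Graph
C6Expansion = Expansion.C6Expansion

-- A colouring of G restricted to H - v gives x, y, z colours a, b, c, and the gadget x′, y′, z′, w
-- guarantees a colour t for v compatible with a, b and c: for both "≠ on three colours" and the
-- (7,2)-relation this is a finite check.  Hence G has neither a 3-colouring nor a (7,2)-colouring, while
-- 3-colouring H - v and giving x′, y′, z′ a fourth colour 4-colours G.  For criticality, every vertex- or
-- edge-deleted subgraph of G is 3-coloured from a 3-colouring of a deleted subgraph of H: deleting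
-- something away from the gadget, collapse x′, y′, z′ onto v's colour; deleting x′y, note that H - vy
-- forces y to take v's colour; deleting x′w, note that H - v forces x, y, z to take three distinct colours.
module Submission where

open import Defs
open import Data.Product using (_×_)
open import Relation.Nullary using (¬_)

open import Data.Bool using (true; _∨_)
open import Data.Empty using (⊥-elim)
open import Data.Fin using (Fin; zero; suc; toℕ; fromℕ; inject₁; punchIn; punchOut)
open import Data.Fin.Patterns using (0F; 1F; 2F; 3F)
open import Data.Fin.Properties
  using ( all?; any?; ¬Fin0; fromℕ≢inject₁; inject₁-injective
        ; punchInᵢ≢i; punchIn-punchOut; punchOut-punchIn; punchOut-cong )
  renaming (_≟_ to _≟ᶠ_)
open import Data.Nat using (ℕ; zero; suc; _+_; _≤_; _≤?_; ∣_-_∣)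
open import Data.Nat.Properties using (∣-∣-comm)
open import Data.Product using (Σ; ∃-syntax; _,_; proj₁; proj₂)
import Data.Product as Product
open import Data.Sum using (_⊎_; inj₁; inj₂)
import Data.Sum as Sum
open import Data.Unit using (⊤; tt)
open import Data.Vec using ([]; _∷_; lookup)
open import Data.Vec.Properties using (lookup∘tabulate)
open import Function using (_∘_)
open import Function.Bundles using (_↔_; Inverse; mk↔ₛ′)
open import Relation.Binary.Definitions using (Symmetric; Decidable)
open import Relation.Binary.PropositionalEquality using (_≡_; _≢_; refl; cong; subst; subst₂; ≢-sym)
import Relation.Binary.PropositionalEquality as ≡
open import Relation.Nullary using (Dec; yes; no; ¬?; _×-dec_; _⊎-dec_; _→-dec_; contradiction)
open import Relation.Nullary.Decidable using (⌊_⌋; from-yes)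
open import Relation.Nullary.Recomputable using (¬-recompute)

isYes-∨⇒⊎ : ∀ {A B : Set} (a? : Dec A) (b? : Dec B) → (⌊ a? ⌋ ∨ ⌊ b? ⌋) ≡ true → A ⊎ B
isYes-∨⇒⊎ (yes a) _ _ = inj₁ a
isYes-∨⇒⊎ (no _) (yes b) _ = inj₂ b
isYes-∨⇒⊎ (no _) (no _) ()

⊎⇒isYes-∨ : ∀ {A B : Set} (a? : Dec A) (b? : Dec B) → A ⊎ B → (⌊ a? ⌋ ∨ ⌊ b? ⌋) ≡ true
⊎⇒isYes-∨ (yes _) _ _ = refl
⊎⇒isYes-∨ (no _) (yes _) _ = refl
⊎⇒isYes-∨ (no ¬a) (no _) (inj₁ a) = contradiction a ¬a
⊎⇒isYes-∨ (no _) (no ¬b) (inj₂ b) = contradiction b ¬b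

≢? : ∀ {n} → Decidable (_≢_ {A = Fin n})
≢? a b = ¬? (a ≟ᶠ b)

avoid-two : (a b : Fin 3) → ∃[ t ] t ≢ a × t ≢ b
avoid-two = from-yes (all? λ (a : Fin 3) → all? λ b → any? λ t → ≢? t a ×-dec ≢? t b)

only-three : ∀ {a b c d : Fin 3} → a ≢ b → c ≢ a → c ≢ b → d ≢ c → d ≢ a → d ≡ b
only-three {a} {b} {c} {d} = from-yes
  (all? λ (a : Fin 3) → all? λ b → all? λ c → all? λ d →
     ≢? a b →-dec ≢? c a →-dec ≢? c b →-dec ≢? d c →-dec ≢? d a →-dec d ≟ᶠ b)
  a b c d

MissingOrInjective : (Fin 3 → Fin 3) → Set
MissingOrInjective f = (∃[ t ] ∀ j → t ≢ f j) ⊎ (∀ i j → i ≢ j → f i ≢ f j)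

missing-or-injective : (f : Fin 3 → Fin 3) → MissingOrInjective f
missing-or-injective f =
  Sum.map (Product.map₂ λ t∉ j → subst (_ ≢_) (lookup∘tabulate f j) (t∉ j))
          (λ inj i j i≢j → subst₂ _≢_ (lookup∘tabulate f i) (lookup∘tabulate f j) (inj i j i≢j))
          (decided (f 0F) (f 1F) (f 2F))
  where
  decided : ∀ a₀ a₁ a₂ → MissingOrInjective (lookup (a₀ ∷ a₁ ∷ a₂ ∷ []))
  decided = from-yes (all? λ (a₀ : Fin 3) → all? λ a₁ → all? λ a₂ →
    let f = lookup (a₀ ∷ a₁ ∷ a₂ ∷ []) in
    (any? λ t → all? λ j → ≢? t (f j)) ⊎-dec (all? λ i → all? λ j → ≢? i j →-dec ≢? (f i) (f j)))

Distant72 : Fin 7 → Fin 7 → Set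
Distant72 a b = 2 ≤ ∣ toℕ a - toℕ b ∣ × ∣ toℕ a - toℕ b ∣ ≤ 5

distant72? : Decidable Distant72
distant72? a b = (2 ≤? ∣ toℕ a - toℕ b ∣) ×-dec (∣ toℕ a - toℕ b ∣ ≤? 5)

distant72-sym : Symmetric Distant72
distant72-sym {a} {b} = subst (λ d → 2 ≤ d × d ≤ 5) (∣-∣-comm (toℕ a) (toℕ b))

-- a, p, s are the colours of x y z, of x′ y′ z′ and of w; t is then a colour for v.
ExtendsOverGadget : {A : Set} → (A → A → Set) → Set
ExtendsOverGadget {A} R = (a p : Fin 3 → A) (s : A) →
  (∀ i j → i ≢ j → R (p i) (a j)) → (∀ i → R s (p i)) → ∃[ t ] ∀ j → R t (a j)

-- Disjunction in this order, so that deciding it looks for t before enumerating gadget colourings.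
GadgetDichotomy : {A : Set} → (A → A → Set) → A → A → A → Set
GadgetDichotomy R a₀ a₁ a₂ =
  (∃[ t ] R t a₀ × R t a₁ × R t a₂) ⊎
  (∀ p₀ → R p₀ a₁ → R p₀ a₂ → ∀ p₁ → R p₁ a₀ → R p₁ a₂ → ∀ p₂ → R p₂ a₀ → R p₂ a₁ →
   ∀ s → R s p₀ → R s p₁ → ¬ R s p₂)

gadgetDichotomy? : ∀ {n} {R : Fin n → Fin n → Set} → Decidable R →
  ∀ a₀ a₁ a₂ → Dec (GadgetDichotomy R a₀ a₁ a₂)
gadgetDichotomy? R? a₀ a₁ a₂ =
  (any? λ t → R? t a₀ ×-dec R? t a₁ ×-dec R? t a₂) ⊎-dec
  (all? λ p₀ → R? p₀ a₁ →-dec R? p₀ a₂ →-dec all? λ p₁ → R? p₁ a₀ →-dec R? p₁ a₂ →-dec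
   all? λ p₂ → R? p₂ a₀ →-dec R? p₂ a₁ →-dec all? λ s → R? s p₀ →-dec R? s p₁ →-dec ¬? (R? s p₂))

extendsOverGadget : ∀ {A : Set} {R : A → A → Set} →
  (∀ a₀ a₁ a₂ → GadgetDichotomy R a₀ a₁ a₂) → ExtendsOverGadget R
extendsOverGadget dichotomy a p s cross spoke with dichotomy (a 0F) (a 1F) (a 2F)
... | inj₁ (t , r₀ , r₁ , r₂) = t , λ { 0F → r₀ ; 1F → r₁ ; 2F → r₂ }
... | inj₂ blocked = ⊥-elim (blocked
  (p 0F) (cross 0F 1F (λ ())) (cross 0F 2F (λ ()))
  (p 1F) (cross 1F 0F (λ ())) (cross 1F 2F (λ ()))
  (p 2F) (cross 2F 0F (λ ())) (cross 2F 1F (λ ()))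
  s (spoke 0F) (spoke 1F) (spoke 2F))

≢-extendsOverGadget : ExtendsOverGadget (_≢_ {A = Fin 3})
≢-extendsOverGadget = extendsOverGadget {R = _≢_}
  (from-yes (all? λ (a₀ : Fin 3) → all? λ a₁ → all? λ a₂ → gadgetDichotomy? ≢? a₀ a₁ a₂))

distant72-extendsOverGadget : ExtendsOverGadget Distant72
distant72-extendsOverGadget = extendsOverGadget
  (from-yes (all? λ a₀ → all? λ a₁ → all? λ a₂ → gadgetDichotomy? distant72? a₀ a₁ a₂))

-- Colourable k G and Col72 G are, definitionally, Colouring _≢_ G and Colouring Distant72 G.
Colouring : {A : Set} → (A → A → Set) → Graph → Set
Colouring {A} R G = Σ (V G → A) λ f → ∀ a b → Edge G a b → R (f a) (f b)

ColourableOn : ℕ → (G : Graph) → (V G → V G → Set) → Set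
ColourableOn k G Kept = Σ (V G → Fin k) λ c → ∀ a b → Edge G a b → Kept a b → c a ≢ c b

ProperSubgraphsColourable : ℕ → Graph → Set₁
ProperSubgraphsColourable k G = (S : Subgraph G) → IsProper S → SubColourable k S

MissesVertex : {A : Set} → A → A → A → Set
MissesVertex u a b = a ≢ u × b ≢ u

MissesEdge : {A : Set} → A → A → A → A → Set
MissesEdge u₀ u₁ a b = ¬ (a ≡ u₀ × b ≡ u₁) × ¬ (a ≡ u₁ × b ≡ u₀)

module _ {A : Set} where

  MissesVertex-sym : {u : A} → Symmetric (MissesVertex u)
  MissesVertex-sym (a≢u , b≢u) = b≢u , a≢u

  MissesEdge-sym : {u₀ u₁ : A} → Symmetric (MissesEdge u₀ u₁)
  MissesEdge-sym (miss₀₁ , miss₁₀) =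
    (λ (b≡u₀ , a≡u₁) → miss₁₀ (a≡u₁ , b≡u₀)) , (λ (b≡u₁ , a≡u₀) → miss₀₁ (a≡u₀ , b≡u₁))

  MissesEdge-swap : {u₀ u₁ a b : A} → MissesEdge u₀ u₁ a b → MissesEdge u₁ u₀ a b
  MissesEdge-swap (miss₀₁ , miss₁₀) = miss₁₀ , miss₀₁

  MissesVertex⇒MissesEdge : {u₀ u₁ a b : A} → MissesVertex u₀ a b → MissesEdge u₀ u₁ a b
  MissesVertex⇒MissesEdge (a≢u₀ , b≢u₀) = a≢u₀ ∘ proj₁ , b≢u₀ ∘ proj₂

module _ {G : Graph} where

  private
    _≟ᵥ_ = _≟_ G

  Edge-sym : ∀ {a b} → Edge G a b → Edge G b a
  Edge-sym {a} {b} = ≡.trans (sym G b a)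

  Edge-irrefl : ∀ {a} → ¬ Edge G a a
  Edge-irrefl {a} e with () ← ≡.trans (≡.sym (irrefl G a)) e

  ColourableOn-mono : ∀ {k} {Kept Kept′ : V G → V G → Set} → (∀ {a b} → Kept′ a b → Kept a b) →
    ColourableOn k G Kept → ColourableOn k G Kept′
  ColourableOn-mono Kept′⊆Kept (c , proper) = c , λ a b e → proper a b e ∘ Kept′⊆Kept

  edgeDeleted⇒vertexDeleted : ∀ {k u₀ u₁} → ColourableOn k G (MissesEdge u₀ u₁) →
    ColourableOn k G (MissesVertex u₀)
  edgeDeleted⇒vertexDeleted = ColourableOn-mono MissesVertex⇒MissesEdge

  vertexDeleted-colourable : ∀ {k} → ProperSubgraphsColourable (suc k) G → ∀ u →
    ColourableOn (suc k) G (MissesVertex u)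
  vertexDeleted-colourable {k} crit u = colour , proper
    where
    G-u : Subgraph G
    G-u = record
      { S = _≢ u ; F = λ a b → Edge G a b × MissesVertex u a b
      ; F-sym = λ a b (e , miss) → Edge-sym e , MissesVertex-sym miss ; F⊆E = λ a b f → f }
    coloured = crit G-u (inj₁ (u , λ u≢u → u≢u refl))
    colour : V G → Fin (suc k)
    colour a with a ≟ᵥ u
    ... | yes _ = zero
    ... | no a≢u = proj₁ coloured a a≢u
    proper : ∀ a b → Edge G a b → MissesVertex u a b → colour a ≢ colour b
    proper a b e (a≢u , b≢u) with a ≟ᵥ u | b ≟ᵥ u
    ... | yes a≡u | _ = contradiction a≡u a≢u
    ... | no _ | yes b≡u = contradiction b≡u b≢u
    ... | no a≢u′ | no b≢u′ = proj₂ coloured a b (e , a≢u′ , b≢u′)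

  edgeDeleted-colourable : ∀ {k u₀ u₁} → ProperSubgraphsColourable k G → Edge G u₀ u₁ →
    ColourableOn k G (MissesEdge u₀ u₁)
  edgeDeleted-colourable {u₀ = u₀} {u₁} crit e₀ =
    (λ a → proj₁ coloured a tt) , λ a b e miss → proj₂ coloured a b (e , miss)
    where
    G-e : Subgraph G
    G-e = record
      { S = λ _ → ⊤ ; F = λ a b → Edge G a b × MissesEdge u₀ u₁ a b
      ; F-sym = λ a b (e , miss) → Edge-sym e , MissesEdge-sym miss ; F⊆E = λ a b (e , _) → e , tt , tt }
    coloured = crit G-e (inj₂ (u₀ , u₁ , e₀ , λ (_ , miss) → proj₁ miss (refl , refl)))

  deletedColourable⇒properSubgraphsColourable : ∀ {k} →
    (∀ u → ColourableOn k G (MissesVertex u)) → (∀ a b → Edge G a b → ColourableOn k G (MissesEdge a b)) →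
    ProperSubgraphsColourable k G
  deletedColourable⇒properSubgraphsColourable vertexDeleted _ G′ (inj₁ (u , u∉S)) =
    (λ a _ → c a) , λ a b f → let (e , a∈S , b∈S) = F⊆E G′ a b f in proper a b e (∉⇒≢ a∈S , ∉⇒≢ b∈S)
    where
    c = proj₁ (vertexDeleted u)
    proper = proj₂ (vertexDeleted u)
    ∉⇒≢ : ∀ {a} → S G′ a → a ≢ u
    ∉⇒≢ a∈S refl = u∉S a∈S
  deletedColourable⇒properSubgraphsColourable _ edgeDeleted G′ (inj₂ (a₀ , b₀ , e₀ , a₀b₀∉F)) =
    (λ a _ → c a) , λ a b f → proper a b (proj₁ (F⊆E G′ a b f))
      ((λ { (refl , refl) → a₀b₀∉F f }) , (λ { (refl , refl) → a₀b₀∉F (F-sym G′ a b f) }))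
    where
    c = proj₁ (edgeDeleted a₀ b₀ e₀)
    proper = proj₂ (edgeDeleted a₀ b₀ e₀)

  restore-edge : ∀ {k u₀ u₁} (c : V G → Fin k) → (∀ a b → Edge G a b → MissesEdge u₀ u₁ a b → c a ≢ c b) →
    c u₀ ≢ c u₁ → Colourable k G
  restore-edge {u₀ = u₀} {u₁} c proper c₀≢c₁ = c , λ a b e →
    proper′ a b e ((a ≟ᵥ u₀) ×-dec (b ≟ᵥ u₁)) ((a ≟ᵥ u₁) ×-dec (b ≟ᵥ u₀))
    where
    proper′ : ∀ a b → Edge G a b → Dec (a ≡ u₀ × b ≡ u₁) → Dec (a ≡ u₁ × b ≡ u₀) → c a ≢ c b
    proper′ a b e (yes (refl , refl)) _ = c₀≢c₁
    proper′ a b e (no _) (yes (refl , refl)) = ≢-sym c₀≢c₁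
    proper′ a b e (no miss₀₁) (no miss₁₀) = proper a b e (miss₀₁ , miss₁₀)

  fill-vertex : ∀ {A : Set} {R : A → A → Set} → Symmetric R → (u : V G) (f : ∀ a → .(a ≢ u) → A) →
    (∀ a b (a≢u : a ≢ u) (b≢u : b ≢ u) → Edge G a b → R (f a a≢u) (f b b≢u)) →
    (t : A) → (∀ b .(b≢u : b ≢ u) → Edge G u b → R t (f b b≢u)) → Colouring R G
  fill-vertex {A} {R} R-sym u f proper t t-fits = colour , proper′
    where
    colour : V G → A
    colour a with a ≟ᵥ u
    ... | yes _ = t
    ... | no a≢u = f a a≢u
    proper′ : ∀ a b → Edge G a b → R (colour a) (colour b)
    proper′ a b e with a ≟ᵥ u | b ≟ᵥ u
    ... | yes refl | yes refl = contradiction e Edge-irrefl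
    ... | yes refl | no b≢u = t-fits b b≢u e
    ... | no a≢u | yes refl = R-sym (t-fits a a≢u (Edge-sym e))
    ... | no a≢u | no b≢u = proper a b a≢u b≢u e

lookup₃-distinct : ∀ {A : Set} {x y z : A} → x ≢ y → x ≢ z → y ≢ z →
  ∀ {i j} → i ≢ j → lookup (x ∷ y ∷ z ∷ []) i ≢ lookup (x ∷ y ∷ z ∷ []) j
lookup₃-distinct _ _ _ {0F} {0F} 0≢0 = contradiction refl 0≢0
lookup₃-distinct x≢y _ _ {0F} {1F} _ = x≢y
lookup₃-distinct _ x≢z _ {0F} {2F} _ = x≢z
lookup₃-distinct x≢y _ _ {1F} {0F} _ = ≢-sym x≢y
lookup₃-distinct _ _ _ {1F} {1F} 1≢1 = contradiction refl 1≢1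
lookup₃-distinct _ _ y≢z {1F} {2F} _ = y≢z
lookup₃-distinct _ x≢z _ {2F} {0F} _ = ≢-sym x≢z
lookup₃-distinct _ _ y≢z {2F} {1F} _ = ≢-sym y≢z
lookup₃-distinct _ _ _ {2F} {2F} 2≢2 = contradiction refl 2≢2

old-cong : ∀ {A : Set} {v a b : A} .{p : a ≢ v} .{q : b ≢ v} → a ≡ b → old {A} {v} a p ≡ old b q
old-cong refl = refl

ExpV-finite : ∀ {A : Set} {v : A} {n} → Fin n ↔ A → Σ ℕ λ m → Fin m ↔ ExpV A v
ExpV-finite {v = v} {zero} Fin↔A = contradiction (Inverse.from Fin↔A v) ¬Fin0
ExpV-finite {A} {v} {suc n} Fin↔A = 4 + n , mk↔ₛ′ to′ from′ to′∘from′ from′∘to′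
  where
  open Inverse Fin↔A
  to-punchIn≢v : ∀ k → to (punchIn (from v) k) ≢ v
  to-punchIn≢v k eq = punchInᵢ≢i (from v) k (≡.trans (≡.sym (strictlyInverseʳ _)) (cong from eq))
  from≢from-v : ∀ {a} → .(a ≢ v) → from v ≢ from a
  from≢from-v a≢v eq =
    ¬-recompute a≢v (≡.trans (≡.sym (strictlyInverseˡ _)) (≡.trans (cong to (≡.sym eq)) (strictlyInverseˡ v)))
  to′ : Fin (4 + n) → ExpV A v
  to′ 0F = x′
  to′ 1F = y′
  to′ 2F = z′
  to′ 3F = w
  to′ (suc (suc (suc (suc k)))) = old (to (punchIn (from v) k)) (to-punchIn≢v k)
  from′ : ExpV A v → Fin (4 + n)
  from′ x′ = 0F
  from′ y′ = 1F
  from′ z′ = 2F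
  from′ w = 3F
  from′ (old a a≢v) = suc (suc (suc (suc (punchOut (from≢from-v a≢v)))))
  to′∘from′ : ∀ a → to′ (from′ a) ≡ a
  to′∘from′ x′ = refl
  to′∘from′ y′ = refl
  to′∘from′ z′ = refl
  to′∘from′ w = refl
  to′∘from′ (old a _) = old-cong (≡.trans (cong to (punchIn-punchOut _)) (strictlyInverseˡ a))
  from′∘to′ : ∀ k → from′ (to′ k) ≡ k
  from′∘to′ 0F = refl
  from′∘to′ 1F = refl
  from′∘to′ 2F = refl
  from′∘to′ 3F = refl
  from′∘to′ (suc (suc (suc (suc k)))) = cong (λ (j : Fin n) → suc (suc (suc (suc j))))
    (≡.trans (punchOut-cong (from v) (strictlyInverseʳ (punchIn (from v) k))) (punchOut-punchIn (from v)))

module C6Expansion-properties (H : Graph) (v x y z : V H) (nb : NbhdIs H v x y z) where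

  private
    _≟ᴴ_ = _≟_ H

  G : Graph
  G = C6Expansion H v x y z

  corner : Fin 3 → V H
  corner = lookup (x ∷ y ∷ z ∷ [])

  corner-edge : ∀ j → Edge H v (corner j)
  corner-edge = let (_ , _ , _ , vx , vy , vz , _) = nb in λ { 0F → vx ; 1F → vy ; 2F → vz }

  corner-complete : ∀ b → Edge H v b → ∃[ j ] b ≡ corner j
  corner-complete b e with (let (_ , _ , _ , _ , _ , _ , complete) = nb in complete b e)
  ... | inj₁ b≡x = 0F , b≡x
  ... | inj₂ (inj₁ b≡y) = 1F , b≡y
  ... | inj₂ (inj₂ b≡z) = 2F , b≡z

  corner-distinct : ∀ {i j} → i ≢ j → corner i ≢ corner j
  corner-distinct = let (x≢y , x≢z , y≢z , _) = nb in lookup₃-distinct x≢y x≢z y≢z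

  corner≢v : ∀ j → corner j ≢ v
  corner≢v j corner≡v = Edge-irrefl {H} (subst (Edge H v) corner≡v (corner-edge j))

  corner′ : Fin 3 → V G
  corner′ j = old (corner j) (corner≢v j)

  primed : Fin 3 → V G
  primed 0F = x′
  primed 1F = y′
  primed 2F = z′

  primed-old-edge : ∀ i {b} .{q} → Edge G (primed i) (old b q) → ∃[ j ] i ≢ j × b ≡ corner j
  primed-old-edge 0F {b} e with isYes-∨⇒⊎ (b ≟ᴴ y) (b ≟ᴴ z) e
  ... | inj₁ b≡y = 1F , (λ ()) , b≡y
  ... | inj₂ b≡z = 2F , (λ ()) , b≡z
  primed-old-edge 1F {b} e with isYes-∨⇒⊎ (b ≟ᴴ x) (b ≟ᴴ z) e
  ... | inj₁ b≡x = 0F , (λ ()) , b≡x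
  ... | inj₂ b≡z = 2F , (λ ()) , b≡z
  primed-old-edge 2F {b} e with isYes-∨⇒⊎ (b ≟ᴴ x) (b ≟ᴴ y) e
  ... | inj₁ b≡x = 0F , (λ ()) , b≡x
  ... | inj₂ b≡y = 1F , (λ ()) , b≡y

  primed-corner-edge : ∀ i j → i ≢ j → Edge G (primed i) (corner′ j)
  primed-corner-edge 0F 1F _ = ⊎⇒isYes-∨ (y ≟ᴴ y) (y ≟ᴴ z) (inj₁ refl)
  primed-corner-edge 0F 2F _ = ⊎⇒isYes-∨ (z ≟ᴴ y) (z ≟ᴴ z) (inj₂ refl)
  primed-corner-edge 1F 0F _ = ⊎⇒isYes-∨ (x ≟ᴴ x) (x ≟ᴴ z) (inj₁ refl)
  primed-corner-edge 1F 2F _ = ⊎⇒isYes-∨ (z ≟ᴴ x) (z ≟ᴴ z) (inj₂ refl)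
  primed-corner-edge 2F 0F _ = ⊎⇒isYes-∨ (x ≟ᴴ x) (x ≟ᴴ y) (inj₁ refl)
  primed-corner-edge 2F 1F _ = ⊎⇒isYes-∨ (y ≟ᴴ x) (y ≟ᴴ y) (inj₂ refl)
  primed-corner-edge 0F 0F 0≢0 = contradiction refl 0≢0
  primed-corner-edge 1F 1F 1≢1 = contradiction refl 1≢1
  primed-corner-edge 2F 2F 2≢2 = contradiction refl 2≢2

  expansionEdge-ind : (P : V G → V G → Set) → Symmetric P →
    (∀ a b .p .q → Edge H a b → P (old a p) (old b q)) →
    (∀ i j → i ≢ j → P (primed i) (corner′ j)) →
    (∀ i → P (primed i) w) →
    ∀ a b → Edge G a b → P a b
  expansionEdge-ind P P-sym inner cross spoke = edge
    where
    primed-old : ∀ i b .q → Edge G (primed i) (old b q) → P (primed i) (old b q)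
    primed-old i b q e with primed-old-edge i e
    ... | j , i≢j , refl = cross i j i≢j
    edge : ∀ a b → Edge G a b → P a b
    edge (old a p) (old b q) e = inner a b p q e
    edge (old a p) x′ e = P-sym (primed-old 0F a p e)
    edge (old a p) y′ e = P-sym (primed-old 1F a p e)
    edge (old a p) z′ e = P-sym (primed-old 2F a p e)
    edge (old a p) w ()
    edge x′ (old b q) e = primed-old 0F b q e
    edge y′ (old b q) e = primed-old 1F b q e
    edge z′ (old b q) e = primed-old 2F b q e
    edge w (old b q) ()
    edge x′ w _ = spoke 0F
    edge y′ w _ = spoke 1F
    edge z′ w _ = spoke 2F
    edge w x′ _ = P-sym (spoke 0F)
    edge w y′ _ = P-sym (spoke 1F)
    edge w z′ _ = P-sym (spoke 2F)
    edge x′ x′ ()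
    edge x′ y′ ()
    edge x′ z′ ()
    edge y′ x′ ()
    edge y′ y′ ()
    edge y′ z′ ()
    edge z′ x′ ()
    edge z′ y′ ()
    edge z′ z′ ()
    edge w w ()

  extend : {C : Set} → (V H → C) → (Fin 3 → C) → C → V G → C
  extend c X W (old a _) = c a
  extend c X W x′ = X 0F
  extend c X W y′ = X 1F
  extend c X W z′ = X 2F
  extend c X W w = W

  extension-colourable : ∀ {k} {Kept : V G → V G → Set} → Symmetric Kept →
    (c : V H → Fin k) (X : Fin 3 → Fin k) (W : Fin k) →
    (∀ a b .p .q → Edge H a b → Kept (old a p) (old b q) → c a ≢ c b) →
    (∀ i j → i ≢ j → Kept (primed i) (corner′ j) → X i ≢ c (corner j)) →
    (∀ i → Kept (primed i) w → X i ≢ W) →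
    ColourableOn k G Kept
  extension-colourable {Kept = Kept} Kept-sym c X W inner cross spoke =
    colour , expansionEdge-ind Proper (λ proper → ≢-sym ∘ proper ∘ Kept-sym) inner cross′ spoke′
    where
    colour = extend c X W
    Proper : V G → V G → Set
    Proper a b = Kept a b → colour a ≢ colour b
    cross′ : ∀ i j → i ≢ j → Proper (primed i) (corner′ j)
    cross′ 0F = cross 0F
    cross′ 1F = cross 1F
    cross′ 2F = cross 2F
    spoke′ : ∀ i → Proper (primed i) w
    spoke′ 0F = spoke 0F
    spoke′ 1F = spoke 1F
    spoke′ 2F = spoke 2F

  fill-v : ∀ {A : Set} {R : A → A → Set} → Symmetric R → (f : ∀ a → .(a ≢ v) → A) →
    (∀ a b (a≢v : a ≢ v) (b≢v : b ≢ v) → Edge H a b → R (f a a≢v) (f b b≢v)) →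
    (t : A) → (∀ j → R t (f (corner j) (corner≢v j))) → Colouring R H
  fill-v {R = R} R-sym f proper t t-fits = fill-vertex {H} R-sym v f proper t t-fits′
    where
    t-fits′ : ∀ b .(b≢v : b ≢ v) → Edge H v b → R t (f b b≢v)
    t-fits′ b _ e with corner-complete b e
    ... | j , refl = t-fits j

  expansion-reflects : ∀ {A : Set} {R : A → A → Set} → Symmetric R → ExtendsOverGadget R →
    Colouring R G → Colouring R H
  expansion-reflects {R = R} R-sym gadget (f , proper) =
    let t , t-fits = gadget (f ∘ corner′) (f ∘ primed) (f w) cross spoke in
    fill-v {R = R} R-sym (λ a a≢v → f (old a a≢v)) (λ a b a≢v b≢v → proper (old a a≢v) (old b b≢v)) t t-fits
    where
    cross : ∀ i j → i ≢ j → R (f (primed i)) (f (corner′ j))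
    cross i j i≢j = proper (primed i) (corner′ j) (primed-corner-edge i j i≢j)
    spoke : ∀ i → R (f w) (f (primed i))
    spoke 0F = proper w x′ refl
    spoke 1F = proper w y′ refl
    spoke 2F = proper w z′ refl

  expansion-4-colourable : ColourableOn 3 H (MissesVertex v) → Colourable 4 G
  expansion-4-colourable (c , c-proper) = Product.map₂ (λ proper a b e → proper a b e tt)
    (extension-colourable {Kept = λ _ _ → ⊤} _ (inject₁ ∘ c) (λ _ → fromℕ 3) zero inner
      (λ _ _ _ _ → fromℕ≢inject₁) (λ _ _ ()))
    where
    inner : ∀ a b .p .q → Edge H a b → ⊤ → inject₁ (c a) ≢ inject₁ (c b)
    inner a b p q e _ = c-proper a b e (¬-recompute p , ¬-recompute q) ∘ inject₁-injective

  oldVertexDeleted-colourable : ∀ a₀ .p₀ → ColourableOn 3 H (MissesVertex a₀) →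
    ColourableOn 3 G (MissesVertex (old a₀ p₀))
  oldVertexDeleted-colourable a₀ p₀ (c , c-proper) with W , W≢cv , _ ← avoid-two (c v) (c v) =
    extension-colourable MissesVertex-sym c (λ _ → c v) W inner cross (λ _ _ → ≢-sym W≢cv)
    where
    inner : ∀ a b .p .q → Edge H a b → MissesVertex (old a₀ p₀) (old a p) (old b q) → c a ≢ c b
    inner a b _ _ e (a≢a₀ , b≢a₀) = c-proper a b e (a≢a₀ ∘ old-cong , b≢a₀ ∘ old-cong)
    cross : ∀ i j → i ≢ j → MissesVertex (old a₀ p₀) (primed i) (corner′ j) → c v ≢ c (corner j)
    cross _ j _ (_ , corner≢a₀) =
      c-proper v (corner j) (corner-edge j) ((λ v≡a₀ → ¬-recompute p₀ (≡.sym v≡a₀)) , corner≢a₀ ∘ old-cong)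

  oldEdgeDeleted-colourable : ∀ a₀ b₀ .p₀ .q₀ → ColourableOn 3 H (MissesEdge a₀ b₀) →
    ColourableOn 3 G (MissesEdge (old a₀ p₀) (old b₀ q₀))
  oldEdgeDeleted-colourable a₀ b₀ p₀ q₀ (c , c-proper) with W , W≢cv , _ ← avoid-two (c v) (c v) =
    extension-colourable MissesEdge-sym c (λ _ → c v) W inner cross (λ _ _ → ≢-sym W≢cv)
    where
    inner : ∀ a b .p .q → Edge H a b → MissesEdge (old a₀ p₀) (old b₀ q₀) (old a p) (old b q) → c a ≢ c b
    inner a b _ _ e (miss₀₁ , miss₁₀) =
      c-proper a b e (miss₀₁ ∘ Product.map old-cong old-cong , miss₁₀ ∘ Product.map old-cong old-cong)
    cross : ∀ i j → i ≢ j → MissesEdge (old a₀ p₀) (old b₀ q₀) (primed i) (corner′ j) → c v ≢ c (corner j)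
    cross _ j _ _ = c-proper v (corner j) (corner-edge j)
      ((λ (v≡a₀ , _) → ¬-recompute p₀ (≡.sym v≡a₀)) , (λ (v≡b₀ , _) → ¬-recompute q₀ (≡.sym v≡b₀)))

  crossDeleted-colourable : ∀ {i j} → i ≢ j → (col : ColourableOn 3 H (MissesEdge v (corner j))) →
    proj₁ col (corner j) ≡ proj₁ col v → ColourableOn 3 G (MissesEdge (primed i) (corner′ j))
  crossDeleted-colourable {i} {j} i≢j (c , c-proper) cj≡cv
    with k , k≢i , k≢j ← avoid-two i j
    with t , t≢ci , t≢cv ← avoid-two (c (corner i)) (c v) =
    -- Primed vertices other than k may copy v's colour: their only clash, primed i ~ corner j, is deleted.
    extension-colourable MissesEdge-sym c X (c (corner i)) inner cross spoke
    where
    X : Fin 3 → Fin 3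
    X l with l ≟ᶠ k
    ... | yes _ = t
    ... | no _ = c v
    v-corner-kept : ∀ {m} → m ≢ j → MissesEdge v (corner j) v (corner m)
    v-corner-kept m≢j =
      (λ (_ , cm≡cj) → corner-distinct m≢j cm≡cj) , (λ (v≡cj , _) → corner≢v j (≡.sym v≡cj))
    inner : ∀ a b .p .q → Edge H a b → MissesEdge (primed i) (corner′ j) (old a p) (old b q) → c a ≢ c b
    inner a b p q e _ =
      c-proper a b e ((λ (a≡v , _) → ¬-recompute p a≡v) , (λ (_ , b≡v) → ¬-recompute q b≡v))
    cross : ∀ l m → l ≢ m → MissesEdge (primed i) (corner′ j) (primed l) (corner′ m) → X l ≢ c (corner m)
    cross l m l≢m (kept , _) with l ≟ᶠ k
    ... | yes refl with m ≟ᶠ i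
    ...   | yes refl = t≢ci
    ...   | no m≢i rewrite only-three i≢j k≢i k≢j (≢-sym l≢m) m≢i = t≢cv ∘ (λ t≡cj → ≡.trans t≡cj cj≡cv)
    cross l m l≢m (kept , _) | no l≢k with m ≟ᶠ j
    ...   | no m≢j = c-proper v (corner m) (corner-edge m) (v-corner-kept m≢j)
    ...   | yes refl = contradiction (cong primed (only-three (≢-sym i≢j) k≢j k≢i l≢k l≢m) , refl) kept
    spoke : ∀ l → MissesEdge (primed i) (corner′ j) (primed l) w → X l ≢ c (corner i)
    spoke l _ with l ≟ᶠ k
    ... | yes _ = t≢ci
    ... | no _ = c-proper v (corner i) (corner-edge i) (v-corner-kept i≢j)

  spokeDeleted-colourable : (col : ColourableOn 3 H (MissesVertex v)) →
    (∀ i j → i ≢ j → proj₁ col (corner i) ≢ proj₁ col (corner j)) →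
    ∀ i → ColourableOn 3 G (MissesEdge (primed i) w)
  spokeDeleted-colourable (c , c-proper) corners-distinct i =
    extension-colourable MissesEdge-sym c (c ∘ corner) (c (corner i))
      inner (λ l m l≢m _ → corners-distinct l m l≢m) spoke
    where
    inner : ∀ a b .p .q → Edge H a b → MissesEdge (primed i) w (old a p) (old b q) → c a ≢ c b
    inner a b p q e _ = c-proper a b e (¬-recompute p , ¬-recompute q)
    spoke : ∀ l → MissesEdge (primed i) w (primed l) w → c (corner l) ≢ c (corner i)
    spoke l (kept , _) = corners-distinct l i (λ l≡i → kept (cong primed l≡i , refl))

  module _ (critH : ProperSubgraphsColourable 3 H) (no3H : ¬ Colourable 3 H) where

    cross-deleted : ∀ i j → i ≢ j → ColourableOn 3 G (MissesEdge (primed i) (corner′ j))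
    cross-deleted i j i≢j with edgeDeleted-colourable critH (corner-edge j)
    ... | col@(c , c-proper) with c (corner j) ≟ᶠ c v
    ...   | yes cj≡cv = crossDeleted-colourable i≢j col cj≡cv
    ...   | no cj≢cv = contradiction (restore-edge {H} c c-proper (≢-sym cj≢cv)) no3H

    spoke-deleted : ∀ i → ColourableOn 3 G (MissesEdge (primed i) w)
    spoke-deleted with vertexDeleted-colourable critH v
    ... | col@(c , c-proper) with missing-or-injective (c ∘ corner)
    ...   | inj₂ corners-distinct = spokeDeleted-colourable col corners-distinct
    ...   | inj₁ (t , t-missing) = contradiction
      (fill-v ≢-sym (λ a _ → c a) (λ a b a≢v b≢v e → c-proper a b e (a≢v , b≢v)) t t-missing) no3H

    edge-deleted : ∀ a b → Edge G a b → ColourableOn 3 G (MissesEdge a b)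
    edge-deleted = expansionEdge-ind (λ a b → ColourableOn 3 G (MissesEdge a b))
      (ColourableOn-mono {G} MissesEdge-swap)
      (λ a b p q e → oldEdgeDeleted-colourable a b p q (edgeDeleted-colourable {H} critH e))
      cross-deleted spoke-deleted

    vertex-deleted : ∀ u → ColourableOn 3 G (MissesVertex u)
    vertex-deleted (old a p) = oldVertexDeleted-colourable a p (vertexDeleted-colourable critH a)
    vertex-deleted x′ = edgeDeleted⇒vertexDeleted {G} (spoke-deleted 0F)
    vertex-deleted y′ = edgeDeleted⇒vertexDeleted {G} (spoke-deleted 1F)
    vertex-deleted z′ = edgeDeleted⇒vertexDeleted {G} (spoke-deleted 2F)
    vertex-deleted w = edgeDeleted⇒vertexDeleted {G} (edge-deleted w x′ refl)

    expansion-critical : ProperSubgraphsColourable 3 G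
    expansion-critical = deletedColourable⇒properSubgraphsColourable vertex-deleted edge-deleted

lemma2p13 : (H : Graph) → IsFinite H → FourCritical H → ¬ Col72 H →
    (v x y z : V H) → NbhdIs H v x y z →
    IsFinite (C6Expansion H v x y z) ×
    FourCritical (C6Expansion H v x y z) ×
    ¬ Col72 (C6Expansion H v x y z)
lemma2p13 H (_ , Fin↔V) ((_ , no3H) , critH) no72H v x y z nb =
  ExpV-finite Fin↔V ,
  ((expansion-4-colourable (vertexDeleted-colourable critH v) ,
    no3H ∘ expansion-reflects {R = _≢_} ≢-sym ≢-extendsOverGadget) ,
   expansion-critical critH no3H) ,
  no72H ∘ expansion-reflects {R = Distant72} (λ {a b} → distant72-sym {a} {b}) distant72-extendsOverGadget
  where open C6Expansion-properties H v x y z nb
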